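{- Let $k \ge 2$ be an integer. There exist constants $c_1 = c_1(k)$ and $c_2 = c_2(k)$ such that for every integer $n \ge 2\cdot 3^k$, $$\frac{nk}{2} - c_1 \le \mathrm{sis}(n, K_{1,k+1}) \le nk + c_2.$$
   Context: All graphs are finite and simple. For a graph $H$, a graph $G$ is $H$-induced-saturated if $G$ contains no induced subgraph isomorphic to $H$, but for every pair of distinct vertices $u,v$ of $G$, the graph obtained from $G$ by adding the edge $uv$ (if $uv\notin E(G)$) or deleting it (if $uv\in E(G)$) contains an induced subgraph isomorphic to $H$. When an $n$-vertex $H$-induced-saturated graph exists, $\mathrm{sis}(n,H)$ denotes the minimum number of edges in an $n$-vertex $H$-induced-saturated graph. (For $k\ge 2$ and $n \ge 3^k$ such graphs exist for $H=K_{1,k+1}$.) -}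

module Defs where

open import Data.Nat using (ℕ; zero; suc; _+_; _<ᵇ_)
open import Data.Fin using (Fin; toℕ; _≟_)
open import Data.Fin.Base as F using ()
open import Data.Bool using (Bool; true; false; not; if_then_else_; _∧_; _∨_)
open import Data.List using (List; map; concatMap; allFin)
open import Data.Nat.ListAction using (sum)
open import Data.Product using (Σ; _×_; _,_)
open import Function.Definitions using (Injective)
open import Relation.Binary.PropositionalEquality using (_≡_)
open import Relation.Nullary using (¬_)
open import Relation.Nullary.Decidable using (⌊_⌋)

Adj : ℕ → Set
Adj n = Fin n → Fin n → Bool

record Graph (n : ℕ) : Set where
  field
    adj    : Adj n
    sym    : ∀ i j → adj i j ≡ adj j i
    irrefl : ∀ i → adj i i ≡ false
open Graph public

edgeCount : ∀ {n} → Graph n → ℕ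
edgeCount {n} G =
  sum (concatMap (λ i → map (λ j → if (toℕ i <ᵇ toℕ j) ∧ adj G i j then 1 else 0)
                            (allFin n))
                 (allFin n))

ContainsInduced : ∀ {m n} → Adj m → Adj n → Set
ContainsInduced {m} {n} H G =
  Σ (Fin m → Fin n) λ f → Injective _≡_ _≡_ f × (∀ a b → G (f a) (f b) ≡ H a b)

toggle : ∀ {n} → Adj n → Fin n → Fin n → Adj n
toggle G u v i j =
  if (⌊ i ≟ u ⌋ ∧ ⌊ j ≟ v ⌋) ∨ (⌊ i ≟ v ⌋ ∧ ⌊ j ≟ u ⌋)
  then not (G i j) else G i j

InducedSaturated : ∀ {m n} → Graph m → Graph n → Set
InducedSaturated H G =
  ¬ ContainsInduced (adj H) (adj G) ×
  (∀ u v → ¬ u ≡ v → ContainsInduced (adj H) (toggle (adj G) u v))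

starAdj : ∀ r → Adj (suc r)
starAdj r Fin.zero Fin.zero = false
starAdj r Fin.zero (Fin.suc _) = true
starAdj r (Fin.suc _) Fin.zero = true
starAdj r (Fin.suc _) (Fin.suc _) = false

star : ∀ r → Graph (suc r)
star r = record { adj = starAdj r ; sym = s ; irrefl = ir }
  where
  s : ∀ i j → starAdj r i j ≡ starAdj r j i
  s Fin.zero Fin.zero = _≡_.refl
  s Fin.zero (Fin.suc _) = _≡_.refl
  s (Fin.suc _) Fin.zero = _≡_.refl
  s (Fin.suc _) (Fin.suc _) = _≡_.refl
  ir : ∀ i → starAdj r i i ≡ false
  ir Fin.zero = _≡_.refl
  ir (Fin.suc _) = _≡_.refl

K1 : ∀ r → Graph (suc r)
K1 r = star r

-- If uv is a non-edge of a K_{1,k+1}-induced-saturated graph G, the induced star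
-- created by adding uv must contain the edge uv, so u or v is its centre and is already adjacent
-- in G to its k other leaves.  Hence the vertices of degree < k are pairwise adjacent, there are
-- at most k of them, and summing degrees gives nk ≤ 2e(G) + k².
--
-- Cut the vertices into rows of N = 3^k consecutive vertices, the last row absorbing
-- the remainder, label each vertex by k base-3 digits, and join two vertices of the same row when
-- their labels differ in at most one coordinate.  A full row is the Hamming graph H(k,3): it is
-- 2k-regular and K_{1,k+1}-free, and toggling any pair creates an induced K_{1,k+1} with an
-- explicitly chosen centre and leaves.  Only the last row, of fewer than 2N vertices, has larger
-- degrees, so e(G) ≤ nk + 2N².

module Submission where

open import Defs hiding (sym)
open import Data.Nat using (ℕ; zero; suc; _+_; _*_; _^_; _∸_; _⊓_; _≤_; _<_; _<ᵇ_; _≤ᵇ_; _≡ᵇ_; z≤n; s≤s; NonZero)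
open import Data.Product using (Σ; _×_; _,_; proj₁; proj₂; ∃)

import Data.Nat as ℕ
open import Data.Nat.Properties
  using (≤-refl; ≤-reflexive; ≤-trans; ≤-antisym; <-trans; <-irrefl; <-asym; <⇒≤; <⇒≱; ≮⇒≥; ≰⇒>; _≤?_;
         n<1+n; m≤m+n; m≤n+m; +-mono-≤; +-monoʳ-≤; +-monoˡ-<; +-cancelʳ-<; *-monoʳ-≤; *-monoˡ-≤; *-cancelˡ-≤;
         +-identityʳ; *-identityʳ; *-comm; m+[n∸m]≡n; m∸n+n≡m; m⊓n≤m; m⊓n≤n; m≤n⇒m⊓n≡m; m≥n⇒m⊓n≡n;
         m^n≢0; ≡⇒≡ᵇ; <ᵇ⇒<; ≤ᵇ⇒≤; <ᵇ-reflects-<; ≤ᵇ-reflects-≤; +-*-semiring; module ≤-Reasoning)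
open import Data.Nat.DivMod
  using (_/_; _%_; _mod_; m≡m%n+[m/n]*n; m/n*n≤m; m≥n⇒m/n>0; m<n⇒m/n≡0; m*n/n≡m; n/1≡n; m/n/o≡m/[n*o];
         +-distrib-/-∣ʳ; m%n<n; [m+kn]%n≡m%n; m<n⇒m%n≡m)
open import Data.Nat.Divisibility using (divides)
open import Data.Nat.Tactic.RingSolver using (solve-∀)
import Data.Nat.ListAction as List
open import Data.Nat.ListAction.Properties using (sum-++)
open import Algebra.Properties.Semiring.Sum +-*-semiring
  using (sum; sum-syntax; sum-cong-≗; sum-replicate-zero; ∑-distrib-+; ∑-comm; *-distribˡ-sum; *-distribʳ-sum)
open import Data.Bool as Bool using (Bool; true; false; not; _∧_; _∨_; if_then_else_; T)
open import Data.Bool.Properties using (∧-comm; ∨-comm; ¬-not)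
open import Data.Fin as Fin using (Fin; toℕ; fromℕ<; _≟_; punchIn)
open import Data.Fin.Patterns using (0F; 1F; 2F)
open import Data.Fin.Properties
  using (toℕ-injective; toℕ<n; toℕ-fromℕ<; suc-injective; <⇒≢; any?; pigeonhole; punchIn-injective; punchInᵢ≢i)
open import Data.List using (List; []; _∷_; _++_; length; map; concatMap; allFin; tabulate; filter; upTo)
open import Data.List.Properties using (map-tabulate; length-++; length-map; length-upTo)
open import Data.List.Membership.Propositional using (_∈_)
open import Data.List.Membership.Propositional.Properties using (∈-map⁺; ∈-++⁺ˡ; ∈-++⁺ʳ; ∈-filter⁺; ∈-allFin; ∈-upTo⁺)
open import Data.List.Relation.Unary.Any using (here; there)
open import Data.Vec using (Vec; []; _∷_; lookup; _[_]≔_)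
open import Data.Vec.Properties using (≡-dec; []≔-idempotent; []≔-lookup; lookup∘update; lookup∘update′)
open import Data.Sum using (_⊎_; inj₁; inj₂)
open import Data.Empty using (⊥-elim)
open import Data.Unit using (tt)
open import Function using (_∘_; id; case_of_)
open import Function.Bundles using (mk⇔)
open import Function.Definitions using (Injective)
open import Relation.Binary.PropositionalEquality
  using (_≡_; _≢_; refl; sym; trans; cong; cong₂; subst; subst₂; module ≡-Reasoning)
open import Relation.Nullary using (¬_; ¬?; Dec; yes; no; does)
open import Relation.Nullary.Decidable using (⌊_⌋; _×-dec_; dec-true; dec-false; does-⇔)
open import Relation.Nullary.Reflects using (ofʸ; ofⁿ)

does-sound : ∀ {A : Set} (a? : Dec A) → does a? ≡ true → A
does-sound (yes a) _ = a

∧-true : ∀ {a b} → a ∧ b ≡ true → a ≡ true × b ≡ true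
∧-true {true} {true} _ = refl , refl

-- Written with if_then_else_ so that edgeCount unfolds to sums of ⟦_⟧.
⟦_⟧ : Bool → ℕ
⟦ b ⟧ = if b then 1 else 0

sum-mono-≤ : ∀ {n} {f g : Fin n → ℕ} → (∀ i → f i ≤ g i) → sum f ≤ sum g
sum-mono-≤ {zero} _ = z≤n
sum-mono-≤ {suc n} f≤g = +-mono-≤ (f≤g Fin.zero) (sum-mono-≤ (λ i → f≤g (Fin.suc i)))

≤-sum : ∀ {n} (f : Fin n → ℕ) i → f i ≤ sum f
≤-sum f Fin.zero = m≤m+n _ _
≤-sum f (Fin.suc i) = ≤-trans (≤-sum (λ j → f (Fin.suc j)) i) (m≤n+m _ _)

sum-const : ∀ n c → ∑[ i < n ] c ≡ n * c
sum-const zero c = refl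
sum-const (suc n) c = cong (c +_) (sum-const n c)

count : ∀ {n} → (Fin n → Bool) → ℕ
count {n} P = ∑[ j < n ] ⟦ P j ⟧

count-mono : ∀ {n} {P Q : Fin n → Bool} → (∀ j → P j ≡ true → Q j ≡ true) → count P ≤ count Q
count-mono {P = P} P⇒Q = sum-mono-≤ λ j → ⟦⟧-mono (P j) (P⇒Q j)
  where
  ⟦⟧-mono : ∀ a {b} → (a ≡ true → b ≡ true) → ⟦ a ⟧ ≤ ⟦ b ⟧
  ⟦⟧-mono false _ = z≤n
  ⟦⟧-mono true a⇒b rewrite a⇒b refl = ≤-refl

count-split : ∀ {n} (P Q : Fin n → Bool) →
              count P ≡ count (λ j → P j ∧ Q j) + count (λ j → P j ∧ not (Q j))
count-split {n} P Q =
  trans (sum-cong-≗ {n} λ j → split (P j) (Q j))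
        (∑-distrib-+ (λ j → ⟦ P j ∧ Q j ⟧) (λ j → ⟦ P j ∧ not (Q j) ⟧))
  where
  split : ∀ a b → ⟦ a ⟧ ≡ ⟦ a ∧ b ⟧ + ⟦ a ∧ not b ⟧
  split false _ = refl
  split true true = refl
  split true false = refl

count-none : ∀ {n} {P : Fin n → Bool} → (∀ j → P j ≡ false) → count P ≡ 0
count-none {n} none = trans (sum-cong-≗ {n} λ j → cong ⟦_⟧ (none j)) (sum-replicate-zero n)

count-≥1 : ∀ {n} {P : Fin n → Bool} x → P x ≡ true → 1 ≤ count P
count-≥1 {P = P} x Px = ≤-trans (≤-reflexive (cong ⟦_⟧ (sym Px))) (≤-sum (λ j → ⟦ P j ⟧) x)

count-≡ᵇ≤1 : ∀ n x → count {n} (λ j → toℕ j ≡ᵇ x) ≤ 1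
count-≡ᵇ≤1 zero x = z≤n
count-≡ᵇ≤1 (suc n) zero = ≤-reflexive (cong suc (count-none {n} {λ j → toℕ (Fin.suc j) ≡ᵇ 0} λ _ → refl))
count-≡ᵇ≤1 (suc n) (suc x) = count-≡ᵇ≤1 n x

count-≤-length : ∀ {n} (P : Fin n → Bool) (xs : List ℕ) →
                 (∀ j → P j ≡ true → toℕ j ∈ xs) → count P ≤ length xs
count-≤-length P [] P⊆[] = ≤-reflexive (count-none λ j → ¬-not λ Pj → case P⊆[] j Pj of λ ())
count-≤-length {n} P (x ∷ xs) P⊆x∷xs = begin
  count P                              ≡⟨ count-split P Q ⟩
  count (λ j → P j ∧ Q j) + count P′
    ≤⟨ +-mono-≤ (≤-trans (count-mono {Q = Q} λ _ → proj₂ ∘ ∧-true) (count-≡ᵇ≤1 n x)) (count-≤-length P′ xs P′⊆xs) ⟩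
  suc (length xs)                      ∎
  where
  open ≤-Reasoning
  Q : Fin n → Bool
  Q j = toℕ j ≡ᵇ x
  P′ : Fin n → Bool
  P′ j = P j ∧ not (Q j)
  P′⊆xs : ∀ j → P′ j ≡ true → toℕ j ∈ xs
  P′⊆xs j P′j with P j in Pj | Q j in Qj | P⊆x∷xs j
  P′⊆xs j () | false | _     | _
  P′⊆xs j () | true  | true  | _
  ... | true | false | P⊆ with P⊆ refl
  ...   | here j≡x   = ⊥-elim (subst T Qj (≡⇒≡ᵇ (toℕ j) x j≡x))
  ...   | there j∈xs = j∈xs

injection⇒≤-count : ∀ {m n} (P : Fin n → Bool) (g : Fin m → Fin n) → Injective _≡_ _≡_ g →
                    (∀ x → P (g x) ≡ true) → m ≤ count P
injection⇒≤-count {zero} P g _ _ = z≤n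
injection⇒≤-count {suc m} {n} P g g-inj Pg = begin
  suc m
    ≤⟨ +-mono-≤ (count-≥1 (g Fin.zero) P∧Q-at-g₀)
                (injection⇒≤-count P′ (g ∘ Fin.suc) (suc-injective ∘ g-inj) P′-at-g) ⟩
  count (λ j → P j ∧ Q j) + count P′   ≡⟨ count-split P Q ⟨
  count P                              ∎
  where
  open ≤-Reasoning
  Q : Fin n → Bool
  Q j = does (j ≟ g Fin.zero)
  P′ : Fin n → Bool
  P′ j = P j ∧ not (Q j)
  P∧Q-at-g₀ : P (g Fin.zero) ∧ Q (g Fin.zero) ≡ true
  P∧Q-at-g₀ rewrite Pg Fin.zero | dec-true (g Fin.zero ≟ g Fin.zero) refl = refl
  P′-at-g : ∀ x → P′ (g (Fin.suc x)) ≡ true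
  P′-at-g x rewrite Pg (Fin.suc x) | dec-false (g (Fin.suc x) ≟ g Fin.zero) (λ e → case g-inj e of λ ()) = refl

deg : ∀ {n} → Graph n → Fin n → ℕ
deg G i = count (adj G i)

listSum-concatMap : ∀ {A : Set} (h : A → List ℕ) xs →
                    List.sum (concatMap h xs) ≡ List.sum (map (List.sum ∘ h) xs)
listSum-concatMap h [] = refl
listSum-concatMap h (x ∷ xs) =
  trans (sum-++ (h x) (concatMap h xs)) (cong (List.sum (h x) +_) (listSum-concatMap h xs))

listSum-allFin : ∀ {n} (f : Fin n → ℕ) → List.sum (map f (allFin n)) ≡ sum f
listSum-allFin f = trans (cong List.sum (map-tabulate id f)) (listSum-tabulate f)
  where
  listSum-tabulate : ∀ {n} (f : Fin n → ℕ) → List.sum (tabulate f) ≡ sum f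
  listSum-tabulate {zero} f = refl
  listSum-tabulate {suc n} f = cong (f Fin.zero +_) (listSum-tabulate (f ∘ Fin.suc))

edgeCount≡∑ : ∀ {n} (G : Graph n) →
              edgeCount G ≡ ∑[ i < n ] count (λ j → (toℕ i <ᵇ toℕ j) ∧ adj G i j)
edgeCount≡∑ {n} G = begin
  edgeCount G                                           ≡⟨ listSum-concatMap entries (allFin n) ⟩
  List.sum (map (List.sum ∘ entries) (allFin n))        ≡⟨ listSum-allFin (List.sum ∘ entries) ⟩
  ∑[ i < n ] List.sum (entries i)                       ≡⟨ sum-cong-≗ {n} (λ i → listSum-allFin (entry i)) ⟩
  ∑[ i < n ] count (λ j → (toℕ i <ᵇ toℕ j) ∧ adj G i j) ∎
  where
  open ≡-Reasoning
  entry : Fin n → Fin n → ℕ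
  entry i j = ⟦ (toℕ i <ᵇ toℕ j) ∧ adj G i j ⟧
  entries : Fin n → List ℕ
  entries i = map (entry i) (allFin n)

adj-split : ∀ {n} (G : Graph n) i j →
            ⟦ adj G i j ⟧ ≡ ⟦ (toℕ i <ᵇ toℕ j) ∧ adj G i j ⟧ + ⟦ (toℕ j <ᵇ toℕ i) ∧ adj G j i ⟧
adj-split G i j with toℕ i <ᵇ toℕ j | <ᵇ-reflects-< (toℕ i) (toℕ j)
                   | toℕ j <ᵇ toℕ i | <ᵇ-reflects-< (toℕ j) (toℕ i)
... | true  | ofʸ i<j  | true  | ofʸ j<i  = ⊥-elim (<-asym i<j j<i)
... | true  | _        | false | _        = sym (+-identityʳ _)
... | false | _        | true  | _        = cong ⟦_⟧ (Graph.sym G i j)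
... | false | ofⁿ i≮j  | false | ofⁿ j≮i
  with refl ← toℕ-injective {i = i} {j} (≤-antisym (≮⇒≥ j≮i) (≮⇒≥ i≮j)) rewrite irrefl G i = refl

handshake : ∀ {n} (G : Graph n) → ∑[ i < n ] deg G i ≡ 2 * edgeCount G
handshake {n} G = begin
  ∑[ i < n ] deg G i                 ≡⟨ sum-cong-≗ {n} (λ i → trans (sum-cong-≗ {n} (adj-split G i))
                                                                  (∑-distrib-+ (forward i) (backward i))) ⟩
  ∑[ i < n ] (sum (forward i) + sum (backward i))
                                     ≡⟨ ∑-distrib-+ (sum ∘ forward) (sum ∘ backward) ⟩
  E + ∑[ i < n ] sum (backward i)    ≡⟨ cong (E +_) (∑-comm (λ i j → forward j i)) ⟩
  E + E                              ≡⟨ cong (λ e → e + e) (edgeCount≡∑ G) ⟨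
  edgeCount G + edgeCount G          ≡⟨ cong (edgeCount G +_) (+-identityʳ _) ⟨
  2 * edgeCount G                    ∎
  where
  open ≡-Reasoning
  forward backward : Fin n → Fin n → ℕ
  forward i j = ⟦ (toℕ i <ᵇ toℕ j) ∧ adj G i j ⟧
  backward i j = ⟦ (toℕ j <ᵇ toℕ i) ∧ adj G j i ⟧
  E : ℕ
  E = ∑[ i < n ] sum (forward i)

toggle-≢ : ∀ {n} (G : Adj n) {u v i j} → ¬ (i ≡ u × j ≡ v) → ¬ (i ≡ v × j ≡ u) →
           toggle G u v i j ≡ G i j
toggle-≢ G {u} {v} {i} {j} ¬uv ¬vu with i ≟ u | j ≟ v | i ≟ v | j ≟ u
... | yes i≡u | yes j≡v | _       | _       = ⊥-elim (¬uv (i≡u , j≡v))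
... | _       | _       | yes i≡v | yes j≡u = ⊥-elim (¬vu (i≡v , j≡u))
... | yes _   | no _    | yes _   | no _    = refl
... | yes _   | no _    | no _    | _       = refl
... | no _    | _       | yes _   | no _    = refl
... | no _    | _       | no _    | _       = refl

toggle-avoidˡ : ∀ {n} (G : Adj n) {u v i} j → i ≢ u → i ≢ v → toggle G u v i j ≡ G i j
toggle-avoidˡ G j i≢u i≢v = toggle-≢ G (i≢u ∘ proj₁) (i≢v ∘ proj₁)

toggle-avoidʳ : ∀ {n} (G : Adj n) {u v} i {j} → j ≢ u → j ≢ v → toggle G u v i j ≡ G i j
toggle-avoidʳ G i j≢u j≢v = toggle-≢ G (j≢v ∘ proj₂) (j≢u ∘ proj₂)

toggle-flip : ∀ {n} (G : Adj n) u v → toggle G u v u v ≡ not (G u v)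
toggle-flip G u v with u ≟ u | v ≟ v
... | yes _  | yes _  = refl
... | no u≢u | _      = ⊥-elim (u≢u refl)
... | yes _  | no v≢v = ⊥-elim (v≢v refl)

-- Toggling changes only the pair uv, so the leaves other than u and v are neighbours of the
-- centre already in G.
centre-degree : ∀ {n k} (G : Graph n) {u v : Fin n}
                ((f , f-inj , f-star) : ContainsInduced (starAdj (suc k)) (toggle (adj G) u v))
                (y : Fin (suc k)) →
                (∀ w → w ≢ f Fin.zero → w ≢ f (Fin.suc y) → w ≢ u × w ≢ v) →
                k ≤ deg G (f Fin.zero)
centre-degree {n} {k} G {u} {v} (f , f-inj , f-star) y uv-covered =
  injection⇒≤-count (adj G (f Fin.zero)) leaf leaf-inj leaf-adj
  where
  leaf : Fin k → Fin n
  leaf x = f (Fin.suc (punchIn y x))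
  leaf-inj : Injective _≡_ _≡_ leaf
  leaf-inj = punchIn-injective y _ _ ∘ suc-injective ∘ f-inj
  leaf-adj : ∀ x → adj G (f Fin.zero) (leaf x) ≡ true
  leaf-adj x = trans (sym (toggle-avoidʳ (adj G) (f Fin.zero) (proj₁ avoids) (proj₂ avoids)))
                     (f-star Fin.zero (Fin.suc (punchIn y x)))
    where
    avoids : leaf x ≢ u × leaf x ≢ v
    avoids = uv-covered (leaf x) (λ e → case f-inj e of λ ()) (punchInᵢ≢i y x ∘ suc-injective ∘ f-inj)

nonEdge-endpointDegree : ∀ {n k} (G : Graph n) {u v : Fin n} →
                         ¬ ContainsInduced (starAdj (suc k)) (adj G) → adj G u v ≡ false →
                         ContainsInduced (starAdj (suc k)) (toggle (adj G) u v) →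
                         k ≤ deg G u ⊎ k ≤ deg G v
nonEdge-endpointDegree {k = k} G {u} {v} free uv-false star@(f , f-inj , f-star)
  with any? (λ a → f a ≟ u) | any? (λ b → f b ≟ v)
... | no ¬hits-u | _ = ⊥-elim (free (f , f-inj , λ a b →
        trans (sym (toggle-≢ (adj G) (¬hits-u ∘ (a ,_) ∘ proj₁) (¬hits-u ∘ (b ,_) ∘ proj₂))) (f-star a b)))
... | yes _ | no ¬hits-v = ⊥-elim (free (f , f-inj , λ a b →
        trans (sym (toggle-≢ (adj G) (¬hits-v ∘ (b ,_) ∘ proj₂) (¬hits-v ∘ (a ,_) ∘ proj₁))) (f-star a b)))
... | yes (a , fa≡u) | yes (b , fb≡v) = endpoint a b fa≡u fb≡v uv-edge
  where
  uv-edge : starAdj (suc k) a b ≡ true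
  uv-edge = begin
    starAdj (suc k) a b           ≡⟨ f-star a b ⟨
    toggle (adj G) u v (f a) (f b) ≡⟨ cong₂ (toggle (adj G) u v) fa≡u fb≡v ⟩
    toggle (adj G) u v u v         ≡⟨ toggle-flip (adj G) u v ⟩
    not (adj G u v)                ≡⟨ cong not uv-false ⟩
    true                           ∎
    where open ≡-Reasoning
  endpoint : ∀ a b → f a ≡ u → f b ≡ v → starAdj (suc k) a b ≡ true → k ≤ deg G u ⊎ k ≤ deg G v
  endpoint Fin.zero (Fin.suc y) refl refl _ =
    inj₁ (centre-degree G star y λ w w≢u w≢v → w≢u , w≢v)
  endpoint (Fin.suc x) Fin.zero refl refl _ =
    inj₂ (centre-degree G star x λ w w≢v w≢u → w≢u , w≢v)

lowDegree-adjacent : ∀ {n k} (G : Graph n) → InducedSaturated (K1 (suc k)) G →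
                     ∀ {i j} → deg G i < k → deg G j < k → i ≢ j → adj G i j ≡ true
lowDegree-adjacent G (free , saturated) {i} {j} i-low j-low i≢j with adj G i j in ij
... | true  = refl
... | false with nonEdge-endpointDegree G free ij (saturated i j i≢j)
...   | inj₁ k≤deg-i = ⊥-elim (<⇒≱ i-low k≤deg-i)
...   | inj₂ k≤deg-j = ⊥-elim (<⇒≱ j-low k≤deg-j)

lowDegreeClique-size : ∀ {n k} (G : Graph n) (P : Fin n → Bool) →
                       (∀ {i j} → P i ≡ true → P j ≡ true → i ≢ j → adj G i j ≡ true) →
                       (∀ {i} → P i ≡ true → deg G i < k) → count P ≤ k
lowDegreeClique-size {n} {k} G P clique low with any? (λ d → P d Bool.≟ true)
... | no ¬some = ≤-trans (≤-reflexive (count-none λ j → ¬-not λ Pj → ¬some (j , Pj))) z≤n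
... | yes (d , Pd) = begin
  count P                                       ≡⟨ count-split P is-d ⟩
  count (λ j → P j ∧ is-d j) + count P-others   ≤⟨ +-mono-≤ (count-≤-length _ (toℕ d ∷ []) at-d)
                                                            (count-mono {Q = adj G d} adjacent-to-d) ⟩
  suc (deg G d)                                 ≤⟨ low Pd ⟩
  k                                             ∎
  where
  open ≤-Reasoning
  is-d : Fin n → Bool
  is-d j = does (j ≟ d)
  P-others : Fin n → Bool
  P-others j = P j ∧ not (is-d j)
  at-d : ∀ j → P j ∧ is-d j ≡ true → toℕ j ∈ toℕ d ∷ []
  at-d j e = here (cong toℕ (does-sound (j ≟ d) (proj₂ (∧-true e))))
  adjacent-to-d : ∀ j → P-others j ≡ true → adj G d j ≡ true
  adjacent-to-d j e with P j in Pj | j ≟ d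
  adjacent-to-d j () | false | _
  adjacent-to-d j () | true  | yes _
  ... | true | no j≢d = clique Pd Pj (j≢d ∘ sym)

saturated-edgeLowerBound : ∀ {n k} (G : Graph n) → InducedSaturated (K1 (suc k)) G →
                           n * k ≤ 2 * edgeCount G + 2 * (k * k)
saturated-edgeLowerBound {n} {k} G saturated = begin
  n * k                                            ≡⟨ sum-const n k ⟨
  ∑[ i < n ] k                                     ≤⟨ sum-mono-≤ k≤deg+k[low] ⟩
  ∑[ i < n ] (deg G i + k * ⟦ low i ⟧)             ≡⟨ ∑-distrib-+ (deg G) (λ i → k * ⟦ low i ⟧) ⟩
  ∑[ i < n ] deg G i + ∑[ i < n ] (k * ⟦ low i ⟧)
                                                   ≡⟨ cong₂ _+_ (handshake G) (sym (*-distribˡ-sum k (λ i → ⟦ low i ⟧))) ⟩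
  2 * edgeCount G + k * count low                  ≤⟨ +-monoʳ-≤ (2 * edgeCount G) (*-monoʳ-≤ k low-count) ⟩
  2 * edgeCount G + k * k                          ≤⟨ +-monoʳ-≤ (2 * edgeCount G) (m≤m+n (k * k) (k * k + 0)) ⟩
  2 * edgeCount G + 2 * (k * k)                    ∎
  where
  open ≤-Reasoning
  low : Fin n → Bool
  low i = deg G i <ᵇ k
  low⇒< : ∀ {i} → low i ≡ true → deg G i < k
  low⇒< {i} e = <ᵇ⇒< (deg G i) k (subst T (sym e) tt)
  k≤deg+k[low] : ∀ i → k ≤ deg G i + k * ⟦ low i ⟧
  k≤deg+k[low] i with deg G i <ᵇ k | <ᵇ-reflects-< (deg G i) k
  ... | true  | _          = ≤-trans (≤-reflexive (sym (*-identityʳ k))) (m≤n+m _ _)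
  ... | false | ofⁿ deg≮k  = ≤-trans (≮⇒≥ deg≮k) (m≤m+n _ _)
  low-count : count low ≤ k
  low-count = lowDegreeClique-size G low (λ li lj → lowDegree-adjacent G saturated (low⇒< li) (low⇒< lj)) low⇒<

toggleGraph : ∀ {n} (G : Graph n) (u v : Fin n) → u ≢ v → Graph n
toggleGraph G u v u≢v = record
  { adj    = toggle (adj G) u v
  ; sym    = λ i j → cong₂ (λ b x → if b then not x else x) (swap-condition i j) (Graph.sym G i j)
  ; irrefl = λ i → trans (toggle-≢ (adj G) (λ (i≡u , i≡v) → u≢v (trans (sym i≡u) i≡v))
                                            (λ (i≡v , i≡u) → u≢v (trans (sym i≡u) i≡v)))
                         (irrefl G i)
  }
  where
  swap-condition : ∀ i j → (⌊ i ≟ u ⌋ ∧ ⌊ j ≟ v ⌋) ∨ (⌊ i ≟ v ⌋ ∧ ⌊ j ≟ u ⌋)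
                         ≡ (⌊ j ≟ u ⌋ ∧ ⌊ i ≟ v ⌋) ∨ (⌊ j ≟ v ⌋ ∧ ⌊ i ≟ u ⌋)
  swap-condition i j = trans (∨-comm (⌊ i ≟ u ⌋ ∧ ⌊ j ≟ v ⌋) _)
                              (cong₂ _∨_ (∧-comm ⌊ i ≟ v ⌋ _) (∧-comm ⌊ i ≟ u ⌋ _))

induced-star : ∀ {n r} (H : Graph n) (c : Fin n) (leaf : Fin r → Fin n) →
               (∀ x → adj H c (leaf x) ≡ true) →
               (∀ x y → x ≢ y → leaf x ≢ leaf y × adj H (leaf x) (leaf y) ≡ false) →
               ContainsInduced (starAdj r) (adj H)
induced-star {n} {r} H c leaf centre-adj leaves-apart = f , f-inj , f-induced
  where
  f : Fin (suc r) → Fin n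
  f Fin.zero    = c
  f (Fin.suc x) = leaf x
  c≢leaf : ∀ x → c ≢ leaf x
  c≢leaf x refl = case trans (sym (irrefl H c)) (centre-adj x) of λ ()
  leaf-inj : Injective _≡_ _≡_ leaf
  leaf-inj {x} {y} e with x ≟ y
  ... | yes x≡y = x≡y
  ... | no x≢y  = ⊥-elim (proj₁ (leaves-apart x y x≢y) e)
  f-inj : Injective _≡_ _≡_ f
  f-inj {Fin.zero}  {Fin.zero}  _ = refl
  f-inj {Fin.zero}  {Fin.suc y} e = ⊥-elim (c≢leaf y e)
  f-inj {Fin.suc x} {Fin.zero}  e = ⊥-elim (c≢leaf x (sym e))
  f-inj {Fin.suc x} {Fin.suc y} e = cong Fin.suc (leaf-inj e)
  f-induced : ∀ a b → adj H (f a) (f b) ≡ starAdj r a b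
  f-induced Fin.zero    Fin.zero    = irrefl H c
  f-induced Fin.zero    (Fin.suc y) = centre-adj y
  f-induced (Fin.suc x) Fin.zero    = trans (Graph.sym H (leaf x) c) (centre-adj x)
  f-induced (Fin.suc x) (Fin.suc y) with x ≟ y
  ... | yes refl = irrefl H (leaf x)
  ... | no x≢y   = proj₂ (leaves-apart x y x≢y)

Word : ℕ → Set
Word m = Vec (Fin 3) m

-- Hamming distance at most one: b agrees with a outside the coordinate l.
Close : ∀ {m} → Word m → Word m → Set
Close {m} a b = Σ (Fin m) λ l → b ≡ a [ l ]≔ lookup b l

close? : ∀ {m} (a b : Word m) → Dec (Close a b)
close? a b = any? (λ l → ≡-dec _≟_ b (a [ l ]≔ lookup b l))

close-refl : ∀ {m} (a : Word (suc m)) → Close a a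
close-refl a = Fin.zero , sym ([]≔-lookup a Fin.zero)

close-sym : ∀ {m} {a b : Word m} → Close a b → Close b a
close-sym {a = a} {b} (l , b≡) = l , sym (begin
  b [ l ]≔ lookup a l                       ≡⟨ cong (_[ l ]≔ lookup a l) b≡ ⟩
  (a [ l ]≔ lookup b l) [ l ]≔ lookup a l   ≡⟨ []≔-idempotent a l ⟩
  a [ l ]≔ lookup a l                       ≡⟨ []≔-lookup a l ⟩
  a                                         ∎)
  where open ≡-Reasoning

close-update : ∀ {m} (a : Word m) l x → Close a (a [ l ]≔ x)
close-update a l x = l , cong (a [ l ]≔_) (sym (lookup∘update l a x))

close-update₂ : ∀ {m} (a : Word m) l x y → Close (a [ l ]≔ x) (a [ l ]≔ y)
close-update₂ a l x y = subst (Close (a [ l ]≔ x)) ([]≔-idempotent a l) (close-update (a [ l ]≔ x) l y)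

close-sameAxis : ∀ {m} {a b b′ : Word m} (p : Close a b) (q : Close a b′) →
                 proj₁ p ≡ proj₁ q → Close b b′
close-sameAxis {a = a} (l , b≡) (.l , b′≡) refl = subst₂ Close (sym b≡) (sym b′≡) (close-update₂ a l _ _)

close-agrees : ∀ {m} {a b : Word m} ((l , _) : Close a b) {i} → i ≢ l → lookup b i ≡ lookup a i
close-agrees {a = a} (l , b≡) i≢l = trans (cong (λ c → lookup c _) b≡) (lookup∘update′ i≢l a _)

update-≢ : ∀ {m} (a : Word m) {l x} → x ≢ lookup a l → a [ l ]≔ x ≢ a
update-≢ a {l} {x} x≢ e = x≢ (trans (sym (lookup∘update l a x)) (cong (λ c → lookup c l) e))

¬close-update₂ : ∀ {m} (a : Word m) {l l′ x y} → l ≢ l′ → x ≢ lookup a l → y ≢ lookup a l′ →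
                 ¬ Close (a [ l ]≔ x) (a [ l′ ]≔ y)
¬close-update₂ a {l} {l′} {x} {y} l≢l′ x≢ y≢ cl@(l₁ , _) with l₁ ≟ l
... | yes refl = y≢ (begin
  y                            ≡⟨ lookup∘update l′ a y ⟨
  lookup (a [ l′ ]≔ y) l′      ≡⟨ close-agrees cl (l≢l′ ∘ sym) ⟩
  lookup (a [ l ]≔ x) l′       ≡⟨ lookup∘update′ (l≢l′ ∘ sym) a x ⟩
  lookup a l′                  ∎)
  where open ≡-Reasoning
... | no l₁≢l = x≢ (begin
  x                            ≡⟨ lookup∘update l a x ⟨
  lookup (a [ l ]≔ x) l        ≡⟨ close-agrees cl (l₁≢l ∘ sym) ⟨
  lookup (a [ l′ ]≔ y) l       ≡⟨ lookup∘update′ l≢l′ a y ⟩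
  lookup a l                   ∎)
  where open ≡-Reasoning

¬close-update : ∀ {m} {a b : Word m} l {x} → ¬ Close a b → x ≢ lookup b l → ¬ Close (a [ l ]≔ x) b
¬close-update {a = a} {b} l {x} ¬ab x≢ cl@(l₁ , b≡) with l₁ ≟ l
... | yes refl = ¬ab (l , trans b≡ ([]≔-idempotent a l))
... | no l₁≢l  = x≢ (trans (sym (lookup∘update l a x)) (sym (close-agrees cl (l₁≢l ∘ sym))))

third : Fin 3 → Fin 3 → Fin 3
third 0F 0F = 1F
third 0F 1F = 2F
third 0F 2F = 1F
third 1F 0F = 2F
third 1F 1F = 0F
third 1F 2F = 0F
third 2F 0F = 1F
third 2F 1F = 0F
third 2F 2F = 0F

third-≢ : ∀ x y → third x y ≢ x × third x y ≢ y
third-≢ 0F 0F = (λ ()) , (λ ())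
third-≢ 0F 1F = (λ ()) , (λ ())
third-≢ 0F 2F = (λ ()) , (λ ())
third-≢ 1F 0F = (λ ()) , (λ ())
third-≢ 1F 1F = (λ ()) , (λ ())
third-≢ 1F 2F = (λ ()) , (λ ())
third-≢ 2F 0F = (λ ()) , (λ ())
third-≢ 2F 1F = (λ ()) , (λ ())
third-≢ 2F 2F = (λ ()) , (λ ())

-- A common neighbour of a and b on a line through both of them.
record Apex {m} (a b : Word m) : Set where
  field
    centre     : Word m
    axis       : Fin m
    a-on-axis  : a ≡ centre [ axis ]≔ lookup a axis
    b-on-axis  : b ≡ centre [ axis ]≔ lookup b axis
    a≢centre   : lookup a axis ≢ lookup centre axis
    b≢centre   : lookup b axis ≢ lookup centre axis

close⇒apex : ∀ {m} {a b : Word m} → Close a b → Apex a b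
close⇒apex {m} {a} {b} (l , b≡) = record
  { centre    = c
  ; axis      = l
  ; a-on-axis = sym (trans ([]≔-idempotent a l) ([]≔-lookup a l))
  ; b-on-axis = trans b≡ (sym ([]≔-idempotent a l))
  ; a≢centre  = λ e → proj₁ (third-≢ _ _) (sym (trans e (lookup∘update l a t)))
  ; b≢centre  = λ e → proj₂ (third-≢ _ _) (sym (trans e (lookup∘update l a t)))
  }
  where
  t : Fin 3
  t = third (lookup a l) (lookup b l)
  c : Word m
  c = a [ l ]≔ t

others : Fin 3 → List (Fin 3)
others x = filter (λ y → ¬? (y ≟ x)) (allFin 3)

neighbours : ∀ {m} → Word m → List (Word m)
neighbours []      = []
neighbours (x ∷ a) = map (_∷ a) (others x) ++ map (x ∷_) (neighbours a)

length-neighbours : ∀ {m} (a : Word m) → length (neighbours a) ≡ m * 2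
length-neighbours [] = refl
length-neighbours {suc m} (x ∷ a) = begin
  length (map (_∷ a) (others x) ++ map (x ∷_) (neighbours a))  ≡⟨ length-++ (map (_∷ a) (others x)) ⟩
  length (map (_∷ a) (others x)) + length (map (x ∷_) (neighbours a))
      ≡⟨ cong₂ _+_ (trans (length-map _ (others x)) (length-others x))
                   (trans (length-map _ (neighbours a)) (length-neighbours a)) ⟩
  2 + m * 2                                                     ∎
  where
  open ≡-Reasoning
  length-others : ∀ x → length (others x) ≡ 2
  length-others 0F = refl
  length-others 1F = refl
  length-others 2F = refl

update∈neighbours : ∀ {m} (a : Word m) l {y} → y ≢ lookup a l → a [ l ]≔ y ∈ neighbours a
update∈neighbours (x ∷ a) Fin.zero y≢x =
  ∈-++⁺ˡ (∈-map⁺ (_∷ a) (∈-filter⁺ (λ y → ¬? (y ≟ x)) (∈-allFin _) y≢x))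
update∈neighbours (x ∷ a) (Fin.suc l) y≢ =
  ∈-++⁺ʳ (map (_∷ a) (others x)) (∈-map⁺ (x ∷_) (update∈neighbours a l y≢))

close⇒∈neighbours : ∀ {m} {a b : Word m} → Close a b → b ≢ a → b ∈ neighbours a
close⇒∈neighbours {a = a} (l , b≡) b≢a =
  subst (_∈ neighbours a) (sym b≡) (update∈neighbours a l λ bₗ≡aₗ →
    b≢a (trans b≡ (trans (cong (a [ l ]≔_) bₗ≡aₗ) ([]≔-lookup a l))))

[m+n*o]/o≡n : ∀ {m} n {o} .{{_ : NonZero o}} → m < o → (m + n * o) / o ≡ n
[m+n*o]/o≡n {m} n {o} m<o =
  trans (+-distrib-/-∣ʳ m (divides n refl)) (cong₂ _+_ (m<n⇒m/n≡0 m<o) (m*n/n≡m n o))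

value : ∀ {m} → Word m → ℕ
value []      = 0
value (x ∷ w) = toℕ x + value w * 3

digits : ∀ m → ℕ → Word m
digits zero    p = []
digits (suc m) p = p mod 3 ∷ digits m (p / 3)

value<3^m : ∀ {m} (w : Word m) → value w < 3 ^ m
value<3^m []      = s≤s z≤n
value<3^m {suc m} (x ∷ w) = begin-strict
  toℕ x + value w * 3    <⟨ +-monoˡ-< (value w * 3) (toℕ<n x) ⟩
  suc (value w) * 3      ≤⟨ *-monoˡ-≤ 3 (value<3^m w) ⟩
  3 ^ m * 3              ≡⟨ *-comm (3 ^ m) 3 ⟩
  3 ^ suc m              ∎
  where open ≤-Reasoning

digits-value : ∀ {m} (w : Word m) r → digits m (value w + r * 3 ^ m) ≡ w
digits-value [] r = refl
digits-value {suc m} (x ∷ w) r = begin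
  digits (suc m) (toℕ x + value w * 3 + r * (3 * 3 ^ m))
    ≡⟨ cong (digits (suc m)) (regroup (toℕ x) (value w) r (3 ^ m)) ⟩
  digits (suc m) (toℕ x + p * 3)
    ≡⟨ cong₂ _∷_ (toℕ-injective lowest-digit) (cong (digits m) ([m+n*o]/o≡n p (toℕ<n x))) ⟩
  x ∷ digits m p
    ≡⟨ cong (x ∷_) (digits-value w r) ⟩
  x ∷ w
    ∎
  where
  open ≡-Reasoning
  p : ℕ
  p = value w + r * 3 ^ m
  regroup : ∀ a b r q → a + b * 3 + r * (3 * q) ≡ a + (b + r * q) * 3
  regroup = solve-∀
  lowest-digit : toℕ ((toℕ x + p * 3) mod 3) ≡ toℕ x
  lowest-digit = begin
    toℕ ((toℕ x + p * 3) mod 3)   ≡⟨ toℕ-fromℕ< (m%n<n (toℕ x + p * 3) 3) ⟩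
    (toℕ x + p * 3) % 3           ≡⟨ [m+kn]%n≡m%n (toℕ x) p 3 ⟩
    toℕ x % 3                     ≡⟨ m<n⇒m%n≡m (toℕ<n x) ⟩
    toℕ x                         ∎

value-digits : ∀ m p .{{_ : NonZero (3 ^ m)}} → p ≡ value (digits m p) + (p / 3 ^ m) * 3 ^ m
value-digits zero p = sym (trans (*-identityʳ (p / 1)) (n/1≡n p))
value-digits (suc m) p = begin
  p
    ≡⟨ m≡m%n+[m/n]*n p 3 ⟩
  p % 3 + (p / 3) * 3
    ≡⟨ cong₂ (λ d q → d + q * 3) (sym (toℕ-fromℕ< (m%n<n p 3))) (value-digits m (p / 3)) ⟩
  toℕ (p mod 3) + (v + (p / 3 / 3 ^ m) * 3 ^ m) * 3
    ≡⟨ cong (λ q → toℕ (p mod 3) + (v + q * 3 ^ m) * 3) (m/n/o≡m/[n*o] p 3 (3 ^ m)) ⟩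
  toℕ (p mod 3) + (v + (p / 3 ^ suc m) * 3 ^ m) * 3
    ≡⟨ regroup (toℕ (p mod 3)) v (p / 3 ^ suc m) (3 ^ m) ⟩
  toℕ (p mod 3) + v * 3 + (p / 3 ^ suc m) * 3 ^ suc m
    ∎
  where
  open ≡-Reasoning
  instance
    3^m≢0 : NonZero (3 ^ m)
    3^m≢0 = m^n≢0 3 m
  v : ℕ
  v = value (digits m (p / 3))
  regroup : ∀ a b r q → a + (b + r * q) * 3 ≡ a + b * 3 + r * (3 * q)
  regroup = solve-∀

module BlockGraph {n k : ℕ} (row : Fin n → ℕ) (label : Fin n → Word (suc k)) where

  Related : Fin n → Fin n → Set
  Related i j = row i ≡ row j × Close (label i) (label j)

  related-sym : ∀ {i j} → Related i j → Related j i
  related-sym (r , c) = sym r , close-sym c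

  unrelated⇒≢ : ∀ {i j} → ¬ Related i j → i ≢ j
  unrelated⇒≢ {i} ¬r refl = ¬r (refl , close-refl (label i))

  related? : ∀ i j → Dec (Related i j)
  related? i j = (row i ℕ.≟ row j) ×-dec close? (label i) (label j)

  adjacent? : ∀ i j → Dec (i ≢ j × Related i j)
  adjacent? i j = ¬? (i ≟ j) ×-dec related? i j

  blockGraph : Graph n
  blockGraph = record
    { adj    = λ i j → does (adjacent? i j)
    ; sym    = λ i j → does-⇔ (mk⇔ flip flip) (adjacent? i j) (adjacent? j i)
    ; irrefl = λ i → dec-false (adjacent? i i) (λ (i≢i , _) → i≢i refl)
    }
    where
    flip : ∀ {i j} → i ≢ j × Related i j → j ≢ i × Related j i
    flip (i≢j , r) = i≢j ∘ sym , related-sym r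

  adj-related : ∀ {i j} → i ≢ j → Related i j → adj blockGraph i j ≡ true
  adj-related {i} {j} i≢j r = dec-true (adjacent? i j) (i≢j , r)

  adj-unrelated : ∀ {i j} → ¬ Related i j → adj blockGraph i j ≡ false
  adj-unrelated {i} {j} ¬r = dec-false (adjacent? i j) (¬r ∘ proj₂)

  adj⇒related : ∀ {i j} → adj blockGraph i j ≡ true → Related i j
  adj⇒related {i} {j} = proj₂ ∘ does-sound (adjacent? i j)

  -- Each leaf differs from the centre in at most one coordinate, its axis; two of the k+2 leaves
  -- share an axis and are then adjacent.
  blockGraph-starFree : ¬ ContainsInduced (starAdj (suc (suc k))) (adj blockGraph)
  blockGraph-starFree (f , f-inj , f-star) = twoLeavesOnAxis (pigeonhole (n<1+n (suc k)) axisOf)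
    where
    centre-related : ∀ x → Related (f Fin.zero) (f (Fin.suc x))
    centre-related x = adj⇒related (f-star Fin.zero (Fin.suc x))
    axisOf : Fin (suc (suc k)) → Fin (suc k)
    axisOf x = proj₁ (proj₂ (centre-related x))
    twoLeavesOnAxis : ¬ ∃ λ x → ∃ λ y → x Fin.< y × axisOf x ≡ axisOf y
    twoLeavesOnAxis (x , y , x<y , sameAxis) =
      case trans (sym (adj-related (<⇒≢ x<y ∘ suc-injective ∘ f-inj) leaves-related))
                 (f-star (Fin.suc x) (Fin.suc y)) of λ ()
      where
      leaves-related : Related (f (Fin.suc x)) (f (Fin.suc y))
      leaves-related = trans (sym (proj₁ (centre-related x))) (proj₁ (centre-related y))
                     , close-sameAxis (proj₂ (centre-related x)) (proj₂ (centre-related y)) sameAxis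

  deg-≤-positionedRow : ∀ i (pos : Word (suc k) → ℕ) →
                        (∀ j → row j ≡ row i → toℕ j ≡ pos (label j)) → deg blockGraph i ≤ suc k * 2
  deg-≤-positionedRow i pos positioned = begin
    deg blockGraph i                          ≤⟨ count-≤-length (adj blockGraph i) (map pos nbrs) nbr∈ ⟩
    length (map pos nbrs)                     ≡⟨ length-map pos nbrs ⟩
    length nbrs                               ≡⟨ length-neighbours (label i) ⟩
    suc k * 2                                 ∎
    where
    open ≤-Reasoning
    nbrs : List (Word (suc k))
    nbrs = neighbours (label i)
    nbr∈ : ∀ j → adj blockGraph i j ≡ true → toℕ j ∈ map pos nbrs
    nbr∈ j ij with does-sound (adjacent? i j) ij
    ... | i≢j , rij , cij =
      subst (_∈ map pos nbrs) (sym (positioned j (sym rij))) (∈-map⁺ pos (close⇒∈neighbours cij labels≢))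
      where
      labels≢ : label j ≢ label i
      labels≢ e = i≢j (toℕ-injective (trans (positioned i refl)
                                           (trans (cong pos (sym e)) (sym (positioned j (sym rij))))))

  module _ (fill : ∀ i w → Σ (Fin n) λ j → row j ≡ row i × label j ≡ w) where

    vertex : Fin n → Word (suc k) → Fin n
    vertex i w = proj₁ (fill i w)

    row-vertex : ∀ i w → row (vertex i w) ≡ row i
    row-vertex i w = proj₁ (proj₂ (fill i w))

    label-vertex : ∀ i w → label (vertex i w) ≡ w
    label-vertex i w = proj₂ (proj₂ (fill i w))

    module _ {u v : Fin n} (u≢v : u ≢ v) where

      H : Graph n
      H = toggleGraph blockGraph u v u≢v

      apartˡ : ∀ {i j} → i ≢ u → i ≢ v → ¬ Related i j → i ≢ j × adj H i j ≡ false
      apartˡ {i} {j} i≢u i≢v ¬r =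
        unrelated⇒≢ ¬r , trans (toggle-avoidˡ (adj blockGraph) j i≢u i≢v) (adj-unrelated ¬r)

      apartʳ : ∀ {i j} → j ≢ u → j ≢ v → ¬ Related i j → i ≢ j × adj H i j ≡ false
      apartʳ {i} {j} j≢u j≢v ¬r =
        unrelated⇒≢ ¬r , trans (toggle-avoidʳ (adj blockGraph) i j≢u j≢v) (adj-unrelated ¬r)

      -- Centre u; leaves v and, for each coordinate l, the vertex of u's row whose label changes
      -- u's in coordinate l to a digit different from those of u and v.
      saturate-nonEdge : ¬ Related u v → ContainsInduced (starAdj (suc (suc k))) (adj H)
      saturate-nonEdge ¬uv = induced-star H u leaf centre-adj leaves-apart
        where
        a b : Word (suc k)
        a = label u
        b = label v
        t : Fin (suc k) → Fin 3
        t l = third (lookup a l) (lookup b l)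
        x : Fin (suc k) → Fin n
        x l = vertex u (a [ l ]≔ t l)
        u-x : ∀ l → Related u (x l)
        u-x l = sym (row-vertex u _) , subst (Close a) (sym (label-vertex u _)) (close-update a l (t l))
        x≢u : ∀ l → x l ≢ u
        x≢u l e = update-≢ a (proj₁ (third-≢ _ _)) (trans (sym (label-vertex u _)) (cong label e))
        v-x : ∀ l → ¬ Related v (x l)
        v-x l (r , c) = ¬close-update l ¬ab (proj₂ (third-≢ _ _)) (close-sym (subst (Close b) (label-vertex u _) c))
          where
          ¬ab : ¬ Close a b
          ¬ab ab = ¬uv (sym (trans r (row-vertex u _)) , ab)
        x≢v : ∀ l → x l ≢ v
        x≢v l = unrelated⇒≢ (v-x l) ∘ sym
        x-x : ∀ {l l′} → l ≢ l′ → ¬ Related (x l) (x l′)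
        x-x l≢l′ (_ , c) = ¬close-update₂ a l≢l′ (proj₁ (third-≢ _ _)) (proj₁ (third-≢ _ _))
                             (subst₂ Close (label-vertex u _) (label-vertex u _) c)
        leaf : Fin (suc (suc k)) → Fin n
        leaf Fin.zero    = v
        leaf (Fin.suc l) = x l
        centre-adj : ∀ y → adj H u (leaf y) ≡ true
        centre-adj Fin.zero    = trans (toggle-flip (adj blockGraph) u v) (cong not (adj-unrelated ¬uv))
        centre-adj (Fin.suc l) = trans (toggle-avoidʳ (adj blockGraph) u (x≢u l) (x≢v l))
                                       (adj-related (x≢u l ∘ sym) (u-x l))
        leaves-apart : ∀ y y′ → y ≢ y′ → leaf y ≢ leaf y′ × adj H (leaf y) (leaf y′) ≡ false
        leaves-apart Fin.zero     Fin.zero      y≢y′ = ⊥-elim (y≢y′ refl)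
        leaves-apart Fin.zero     (Fin.suc l)   _    = apartʳ (x≢u l) (x≢v l) (v-x l)
        leaves-apart (Fin.suc l)  Fin.zero      _    = apartˡ (x≢u l) (x≢v l) (v-x l ∘ related-sym)
        leaves-apart (Fin.suc l)  (Fin.suc l′)  y≢y′ = apartˡ (x≢u l) (x≢v l) (x-x (y≢y′ ∘ cong Fin.suc))

      -- Centre the vertex w labelled by an apex of u and v; leaves u, v and a neighbour of w in
      -- each of the other coordinates.
      saturate-edge : Related u v → ContainsInduced (starAdj (suc (suc k))) (adj H)
      saturate-edge uv@(ruv , cuv) = induced-star H w leaf centre-adj leaves-apart
        where
        open Apex (close⇒apex cuv) renaming (centre to c; axis to l₀)
        w : Fin n
        w = vertex u c
        label-w : label w ≡ c
        label-w = label-vertex u c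
        o : Fin k → Fin 3
        o j = third (lookup c (punchIn l₀ j)) (lookup c (punchIn l₀ j))
        y : Fin k → Fin n
        y j = vertex u (c [ punchIn l₀ j ]≔ o j)
        label-y : ∀ j → label (y j) ≡ c [ punchIn l₀ j ]≔ o j
        label-y j = label-vertex u _
        w≢u : w ≢ u
        w≢u e = update-≢ c a≢centre (trans (sym a-on-axis) (trans (cong label (sym e)) label-w))
        w≢v : w ≢ v
        w≢v e = update-≢ c b≢centre (trans (sym b-on-axis) (trans (cong label (sym e)) label-w))
        w-u : Related w u
        w-u = row-vertex u c , subst₂ Close (sym label-w) (sym a-on-axis) (close-update c l₀ _)
        w-v : Related w v
        w-v = trans (row-vertex u c) ruv , subst₂ Close (sym label-w) (sym b-on-axis) (close-update c l₀ _)
        w-y : ∀ j → Related w (y j)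
        w-y j = trans (row-vertex u c) (sym (row-vertex u _))
              , subst₂ Close (sym label-w) (sym (label-y j)) (close-update c _ _)
        off-axis : ∀ {d} → d ≢ lookup c l₀ → ∀ j → ¬ Close (c [ l₀ ]≔ d) (c [ punchIn l₀ j ]≔ o j)
        off-axis d≢ j = ¬close-update₂ c (punchInᵢ≢i l₀ j ∘ sym) d≢ (proj₁ (third-≢ _ _))
        u-y : ∀ j → ¬ Related u (y j)
        u-y j (_ , cl) = off-axis a≢centre j (subst₂ Close a-on-axis (label-y j) cl)
        v-y : ∀ j → ¬ Related v (y j)
        v-y j (_ , cl) = off-axis b≢centre j (subst₂ Close b-on-axis (label-y j) cl)
        y-y : ∀ {i j} → i ≢ j → ¬ Related (y i) (y j)
        y-y i≢j (_ , cl) = ¬close-update₂ c (i≢j ∘ punchIn-injective l₀ _ _)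
                             (proj₁ (third-≢ _ _)) (proj₁ (third-≢ _ _)) (subst₂ Close (label-y _) (label-y _) cl)
        y≢u : ∀ j → y j ≢ u
        y≢u j = unrelated⇒≢ (u-y j) ∘ sym
        y≢v : ∀ j → y j ≢ v
        y≢v j = unrelated⇒≢ (v-y j) ∘ sym
        leaf : Fin (suc (suc k)) → Fin n
        leaf Fin.zero                = u
        leaf (Fin.suc Fin.zero)      = v
        leaf (Fin.suc (Fin.suc j))   = y j
        centre-adj : ∀ z → adj H w (leaf z) ≡ true
        centre-adj z = trans (toggle-avoidˡ (adj blockGraph) (leaf z) w≢u w≢v) (adj-related (w≢leaf z) (w-leaf z))
          where
          w-leaf : ∀ z → Related w (leaf z)
          w-leaf Fin.zero              = w-u
          w-leaf (Fin.suc Fin.zero)    = w-v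
          w-leaf (Fin.suc (Fin.suc j)) = w-y j
          w≢leaf : ∀ z → w ≢ leaf z
          w≢leaf Fin.zero              = w≢u
          w≢leaf (Fin.suc Fin.zero)    = w≢v
          w≢leaf (Fin.suc (Fin.suc j)) e =
            update-≢ c (proj₁ (third-≢ _ _)) (trans (sym (label-y j)) (trans (cong label (sym e)) label-w))
        uv-toggled : adj H u v ≡ false
        uv-toggled = trans (toggle-flip (adj blockGraph) u v) (cong not (adj-related u≢v uv))
        leaves-apart : ∀ z z′ → z ≢ z′ → leaf z ≢ leaf z′ × adj H (leaf z) (leaf z′) ≡ false
        leaves-apart Fin.zero Fin.zero z≢z′ = ⊥-elim (z≢z′ refl)
        leaves-apart (Fin.suc Fin.zero) (Fin.suc Fin.zero) z≢z′ = ⊥-elim (z≢z′ refl)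
        leaves-apart Fin.zero (Fin.suc Fin.zero) _ = u≢v , uv-toggled
        leaves-apart (Fin.suc Fin.zero) Fin.zero _ = u≢v ∘ sym , trans (Graph.sym H v u) uv-toggled
        leaves-apart Fin.zero (Fin.suc (Fin.suc j)) _ = apartʳ (y≢u j) (y≢v j) (u-y j)
        leaves-apart (Fin.suc Fin.zero) (Fin.suc (Fin.suc j)) _ = apartʳ (y≢u j) (y≢v j) (v-y j)
        leaves-apart (Fin.suc (Fin.suc i)) Fin.zero _ = apartˡ (y≢u i) (y≢v i) (u-y i ∘ related-sym)
        leaves-apart (Fin.suc (Fin.suc i)) (Fin.suc Fin.zero) _ = apartˡ (y≢u i) (y≢v i) (v-y i ∘ related-sym)
        leaves-apart (Fin.suc (Fin.suc i)) (Fin.suc (Fin.suc j)) z≢z′ =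
          apartˡ (y≢u i) (y≢v i) (y-y (z≢z′ ∘ cong (Fin.suc ∘ Fin.suc)))

      saturate : ContainsInduced (starAdj (suc (suc k))) (adj H)
      saturate with related? u v
      ... | yes uv = saturate-edge uv
      ... | no ¬uv = saturate-nonEdge ¬uv

    blockGraph-saturated : InducedSaturated (K1 (suc (suc k))) blockGraph
    blockGraph-saturated = blockGraph-starFree , λ u v u≢v → saturate u≢v

-- Vertex i lies in row ⌊i/N⌋, capped so that the incomplete last block joins the last full row,
-- and is labelled by the lowest k+1 base-3 digits of i; each label occurs exactly once in every row
-- but the last.
module BlockLabelling (k n : ℕ) (N≤n : 3 ^ suc k ≤ n) where

  N : ℕ
  N = 3 ^ suc k

  instance
    N≢0 : NonZero N
    N≢0 = m^n≢0 3 (suc k)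

  lastRow : ℕ
  lastRow = n / N ∸ 1

  row : Fin n → ℕ
  row i = (toℕ i / N) ⊓ lastRow

  label : Fin n → Word (suc k)
  label i = digits (suc k) (toℕ i)

  position : ℕ → Word (suc k) → ℕ
  position r w = value w + r * N

  suc-lastRow : suc lastRow ≡ n / N
  suc-lastRow = m+[n∸m]≡n (m≥n⇒m/n>0 N≤n)

  n<[2+lastRow]*N : n < 2 * N + lastRow * N
  n<[2+lastRow]*N = begin-strict
    n                       ≡⟨ m≡m%n+[m/n]*n n N ⟩
    n % N + n / N * N       <⟨ +-monoˡ-< (n / N * N) (m%n<n n N) ⟩
    N + n / N * N           ≡⟨ cong (λ q → N + q * N) suc-lastRow ⟨
    N + (N + lastRow * N)   ≡⟨ double N (lastRow * N) ⟩
    2 * N + lastRow * N     ∎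
    where
    open ≤-Reasoning
    double : ∀ a b → a + (a + b) ≡ 2 * a + b
    double = solve-∀

  position<n : ∀ {r} → r ≤ lastRow → ∀ w → position r w < n
  position<n {r} r≤last w = begin-strict
    value w + r * N         <⟨ +-monoˡ-< (r * N) (value<3^m w) ⟩
    suc r * N               ≤⟨ *-monoˡ-≤ N (s≤s r≤last) ⟩
    suc lastRow * N         ≡⟨ cong (_* N) suc-lastRow ⟩
    n / N * N               ≤⟨ m/n*n≤m n N ⟩
    n                       ∎
    where open ≤-Reasoning

  fill : ∀ i w → Σ (Fin n) λ j → row j ≡ row i × label j ≡ w
  fill i w = j , row-j , label-j
    where
    r : ℕ
    r = row i
    r≤last : r ≤ lastRow
    r≤last = m⊓n≤n _ lastRow
    j : Fin n
    j = fromℕ< (position<n r≤last w)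
    toℕ-j : toℕ j ≡ position r w
    toℕ-j = toℕ-fromℕ< (position<n r≤last w)
    row-j : row j ≡ r
    row-j = trans (cong (λ p → p / N ⊓ lastRow) toℕ-j)
                  (trans (cong (_⊓ lastRow) ([m+n*o]/o≡n r (value<3^m w))) (m≤n⇒m⊓n≡m r≤last))
    label-j : label j ≡ w
    label-j = trans (cong (digits (suc k)) toℕ-j) (digits-value w r)

  positioned : ∀ {i} → row i < lastRow → ∀ j → row j ≡ row i → toℕ j ≡ position (row i) (label j)
  positioned {i} i<last j same = begin
    toℕ j                                  ≡⟨ value-digits (suc k) (toℕ j) ⟩
    value (label j) + toℕ j / N * N        ≡⟨ cong (λ r → value (label j) + r * N) (trans quotient same) ⟩
    position (row i) (label j)             ∎
    where
    open ≡-Reasoning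
    quotient : toℕ j / N ≡ row j
    quotient with toℕ j / N ≤? lastRow
    ... | yes q≤last = sym (m≤n⇒m⊓n≡m q≤last)
    ... | no  q≰last =
      ⊥-elim (<-irrefl (m≥n⇒m⊓n≡n (<⇒≤ (≰⇒> q≰last))) (subst (_< lastRow) (sym same) i<last))

  lastRowPositions : List ℕ
  lastRowPositions = map (lastRow * N +_) (upTo (2 * N))

  lastRow⇒∈positions : ∀ {j} → lastRow ≤ row j → toℕ j ∈ lastRowPositions
  lastRow⇒∈positions {j} last≤row =
    subst (_∈ lastRowPositions) (m+[n∸m]≡n start≤j) (∈-map⁺ (lastRow * N +_) (∈-upTo⁺ offset<2N))
    where
    start≤j : lastRow * N ≤ toℕ j
    start≤j = ≤-trans (*-monoˡ-≤ N (≤-trans last≤row (m⊓n≤m _ _))) (m/n*n≤m (toℕ j) N)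
    offset<2N : toℕ j ∸ lastRow * N < 2 * N
    offset<2N = +-cancelʳ-< (lastRow * N) _ _ (begin-strict
      toℕ j ∸ lastRow * N + lastRow * N   ≡⟨ m∸n+n≡m start≤j ⟩
      toℕ j                               <⟨ <-trans (toℕ<n j) n<[2+lastRow]*N ⟩
      2 * N + lastRow * N                 ∎)
      where open ≤-Reasoning

  count-lastRow≤2N : (P : Fin n → Bool) → (∀ j → P j ≡ true → lastRow ≤ row j) → count P ≤ 2 * N
  count-lastRow≤2N P inLast = begin
    count P                          ≤⟨ count-≤-length P lastRowPositions (λ j → lastRow⇒∈positions ∘ inLast j) ⟩
    length lastRowPositions          ≡⟨ length-map (lastRow * N +_) (upTo (2 * N)) ⟩
    length (upTo (2 * N))            ≡⟨ length-upTo (2 * N) ⟩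
    2 * N                            ∎
    where open ≤-Reasoning

  open BlockGraph row label public

  inLastRow : Fin n → Bool
  inLastRow i = lastRow ≤ᵇ row i

  deg-bound : ∀ i → deg blockGraph i ≤ suc k * 2 + ⟦ inLastRow i ⟧ * (2 * N)
  deg-bound i with lastRow ≤ᵇ row i | ≤ᵇ-reflects-≤ lastRow (row i)
  ... | true  | ofʸ last≤i = begin
    deg blockGraph i                 ≤⟨ count-lastRow≤2N (adj blockGraph i) sameRow ⟩
    2 * N                            ≡⟨ +-identityʳ (2 * N) ⟨
    1 * (2 * N)                      ≤⟨ m≤n+m _ (suc k * 2) ⟩
    suc k * 2 + 1 * (2 * N)          ∎
    where
    open ≤-Reasoning
    sameRow : ∀ j → adj blockGraph i j ≡ true → lastRow ≤ row j
    sameRow j ij = ≤-trans last≤i (≤-reflexive (proj₁ (adj⇒related ij)))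
  ... | false | ofⁿ last≰i =
    ≤-trans (deg-≤-positionedRow i (position (row i)) (positioned (≰⇒> last≰i))) (m≤m+n _ _)

  blockGraph-edgeUpperBound : edgeCount blockGraph ≤ n * suc k + 2 * N * N
  blockGraph-edgeUpperBound = *-cancelˡ-≤ 2 (begin
    2 * edgeCount blockGraph
      ≡⟨ handshake blockGraph ⟨
    ∑[ i < n ] deg blockGraph i
      ≤⟨ sum-mono-≤ deg-bound ⟩
    ∑[ i < n ] (suc k * 2 + ⟦ inLastRow i ⟧ * (2 * N))
      ≡⟨ ∑-distrib-+ (λ _ → suc k * 2) (λ i → ⟦ inLastRow i ⟧ * (2 * N)) ⟩
    ∑[ i < n ] (suc k * 2) + ∑[ i < n ] (⟦ inLastRow i ⟧ * (2 * N))
      ≡⟨ cong₂ _+_ (sum-const n (suc k * 2)) (sym (*-distribʳ-sum (2 * N) (λ i → ⟦ inLastRow i ⟧))) ⟩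
    n * (suc k * 2) + count inLastRow * (2 * N)
      ≤⟨ +-monoʳ-≤ (n * (suc k * 2)) (*-monoˡ-≤ (2 * N) lastRows) ⟩
    n * (suc k * 2) + 2 * N * (2 * N)
      ≡⟨ rearrange n (suc k) N ⟩
    2 * (n * suc k + 2 * N * N)
      ∎)
    where
    open ≤-Reasoning
    lastRows : count inLastRow ≤ 2 * N
    lastRows = count-lastRow≤2N inLastRow λ j e → ≤ᵇ⇒≤ lastRow (row j) (subst T (sym e) tt)
    rearrange : ∀ a b c → a * (b * 2) + 2 * c * (2 * c) ≡ 2 * (a * b + 2 * c * c)
    rearrange = solve-∀

theorem3p4 : (k : ℕ) → 2 ≤ k →
    Σ ℕ λ c₁ → Σ ℕ λ c₂ → (n : ℕ) → 2 * 3 ^ k ≤ n →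
      (Σ (Graph n) λ G → InducedSaturated (K1 (suc k)) G × edgeCount G ≤ n * k + c₂)
      × ((G : Graph n) → InducedSaturated (K1 (suc k)) G → n * k ≤ 2 * edgeCount G + 2 * c₁)
theorem3p4 zero ()
theorem3p4 (suc k) _ = suc k * suc k , 2 * 3 ^ suc k * 3 ^ suc k , λ n 2·3^k≤n →
  let open BlockLabelling k n (≤-trans (m≤m+n _ _) 2·3^k≤n)
  in (blockGraph , blockGraph-saturated fill , blockGraph-edgeUpperBound) , saturated-edgeLowerBound
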